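{- Let $K\ge4$ and let $H$ be a signed bipartite graph. If a signed bipartite graph $G=(G_1,G_2)$ with $|G_1|=m$, $|G_2|=n$ has at least $K\cdot z(m,n,H)$ edges, then $G$ contains at least $\left(\frac K2\right)^{\mathrm{e}(H)}z(m,n,H)$ signed copies of $H$.
   Context: A signed bipartite graph is a bipartite graph $H=(H_1,H_2)$ with a fixed ordered bipartition (its $+$ and $-$ sides). A signed copy of $H=(H_1,H_2)$ in a signed bipartite graph $G=(G_1,G_2)$ is a copy of $H$ in $G$ with $H_1$ mapped into $G_1$ and $H_2$ into $G_2$. The Zarankiewicz number $z(m,n,H)$ is the maximum number of edges of a signed bipartite graph $G=(G_1,G_2)$ with $|G_1|=m$, $|G_2|=n$ containing no signed copy of $H$. $\mathrm{e}(H)$ is the number of edges of $H$.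
   Formalization: The constant $K$ is taken to be rational. -}

module Defs where

open import Data.Bool using (Bool; true; false)
open import Data.Nat using (ℕ; zero; suc; _+_; _≤_)
open import Data.Fin using (Fin)
open import Data.Fin.Subset using (Subset; _∈_)
open import Data.Vec using (Vec; lookup; foldr; map; count)
open import Data.Product using (Σ; ∃; ∃-syntax; _×_; _,_)
open import Function.Bundles using (_⇔_)
open import Function.Definitions using (Injective)
open import Relation.Binary.PropositionalEquality using (_≡_)
open import Relation.Nullary.Decidable using (does)
open import Data.Bool using (_≟_)
open import Data.Empty using (⊥)

-- A signed bipartite graph (G₁ , G₂) with |G₁| = m (the + side) and
-- |G₂| = n (the − side), given by its biadjacency matrix:
-- row i (vertex i of G₁), column j (vertex j of G₂).
BipGraph : ℕ → ℕ → Set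
BipGraph m n = Vec (Vec Bool n) m

Adj : ∀ {m n} → BipGraph m n → Fin m → Fin n → Set
Adj G i j = lookup (lookup G i) j ≡ true

rowEdges : ∀ {n} → Vec Bool n → ℕ
rowEdges = count (λ x → x ≟ true)

edges : ∀ {m n} → BipGraph m n → ℕ
edges G = foldr (λ _ → ℕ) _+_ 0 (map rowEdges G)

record SignedEmbedding {a b m n : ℕ} (H : BipGraph a b) (G : BipGraph m n) : Set where
  field
    f     : Fin a → Fin m
    g     : Fin b → Fin n
    f-inj : Injective _≡_ _≡_ f
    g-inj : Injective _≡_ _≡_ g
    hom   : ∀ i j → Adj H i j → Adj G (f i) (g j)

ContainsSignedCopy : ∀ {a b m n} → BipGraph a b → BipGraph m n → Set
ContainsSignedCopy H G = SignedEmbedding H G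

SubgraphData : ℕ → ℕ → Set
SubgraphData m n = Subset m × Subset n × BipGraph m n

IsSignedCopy : ∀ {a b m n} → BipGraph a b → BipGraph m n → SubgraphData m n → Set
IsSignedCopy H G (A , B , E) =
  Σ (SignedEmbedding H G) λ φ →
    let open SignedEmbedding φ in
      (∀ x → (x ∈ A) ⇔ (∃[ i ] f i ≡ x))
    × (∀ y → (y ∈ B) ⇔ (∃[ j ] g j ≡ y))
    × (∀ x y → Adj E x y ⇔ (∃[ i ] ∃[ j ] (f i ≡ x × g j ≡ y × Adj H i j)))

IsZarankiewicz : ∀ {a b} → ℕ → ℕ → BipGraph a b → ℕ → Set
IsZarankiewicz m n H z =
    (∃[ G ] ((SignedEmbedding H G → ⊥) × edges {m} {n} G ≡ z))
  × (∀ (G : BipGraph m n) → (SignedEmbedding H G → ⊥) → edges G ≤ z)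

-- Keep each edge of G independently with probability 2/K, giving a random subgraph S.
-- Deleting one edge from each signed copy of H inside S leaves an H-free graph, so
-- e(S) ≤ z + #(copies inside S).  Taking expectations, with N the number of copies,
-- (2/K) e(G) ≤ z + N (2/K)^e(H), and e(G) ≥ K z turns this into N ≥ (K/2)^e(H) z.
-- Expectations are taken with natural-number weights α = 2q, β = p − 2q (K = p/q),
-- and only K ≥ 2 is needed.

module Submission where

open import Defs
open import Data.Nat using (ℕ; zero; suc; _+_; _*_; _^_; _≤_; z≤n; s≤s; NonZero; >-nonZero; >-nonZero⁻¹)
open import Data.Nat.Properties
open import Data.Nat.ListAction using (sum)
open import Data.Nat.Tactic.RingSolver using (solve-∀)
open import Data.Bool using (Bool; true; false)
import Data.Bool as B
open import Data.Fin as F using (Fin)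
import Data.Fin.Properties as FP
open import Data.Fin.Subset using (Subset) renaming (_∈_ to _∈ₛ_)
open import Data.Vec using (Vec; []; _∷_; lookup; tabulate; _[_]%=_; _[_]≔_)
import Data.Vec.Properties as VP
open import Data.List
  using (List; []; _∷_; length; map; filter; deduplicate; cartesianProduct; cartesianProductWith; allFin)
open import Data.List.Properties using (length-map)
open import Data.List.Membership.Propositional using (_∈_)
open import Data.List.Membership.Propositional.Properties
  using (∈-map⁺; ∈-filter⁺; ∈-deduplicate⁺; ∈-cartesianProduct⁺; ∈-cartesianProductWith⁺; ∈-allFin)
open import Data.List.Relation.Unary.Any using (here; there)
open import Data.List.Relation.Unary.All as All using (All; []; _∷_)
import Data.List.Relation.Unary.All.Properties as AllP
open import Data.List.Relation.Unary.Unique.Propositional using (Unique)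
open import Data.List.Relation.Unary.Unique.DecPropositional.Properties using (deduplicate-!)
open import Data.Product using (∃-syntax; _×_; _,_; proj₁; proj₂)
import Data.Product.Properties as PP
open import Data.Sum using (_⊎_; inj₁; inj₂)
open import Data.Empty using (⊥-elim)
open import Function.Base using (_∘_)
open import Function.Bundles using (_⇔_; mk⇔; Equivalence)
open import Function.Definitions using (Injective)
open import Relation.Binary.PropositionalEquality
open import Relation.Binary.Definitions using (DecidableEquality)
open import Relation.Nullary using (Dec; yes; no; does; ¬_)
open import Relation.Nullary.Decidable using (_×-dec_; _→-dec_; map′)

_⊆ᵣ_ : ∀ {n} → Vec Bool n → Vec Bool n → Set
s ⊆ᵣ r = ∀ y → lookup s y ≡ true → lookup r y ≡ true

_⊆ᴳ_ : ∀ {m n} → BipGraph m n → BipGraph m n → Set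
S ⊆ᴳ M = ∀ x y → Adj S x y → Adj M x y

⊆ᵣ-∷true : ∀ {n} (b : Bool) {s r : Vec Bool n} → s ⊆ᵣ r → (b ∷ s) ⊆ᵣ (true ∷ r)
⊆ᵣ-∷true b s⊆r F.zero    _  = refl
⊆ᵣ-∷true b s⊆r (F.suc y) sy = s⊆r y sy

⊆ᵣ-∷false : ∀ {n} {s r : Vec Bool n} → s ⊆ᵣ r → (false ∷ s) ⊆ᵣ (false ∷ r)
⊆ᵣ-∷false s⊆r F.zero    ()
⊆ᵣ-∷false s⊆r (F.suc y) sy = s⊆r y sy

⊆ᵣ-tail : ∀ {n} {b c : Bool} {s r : Vec Bool n} → (b ∷ s) ⊆ᵣ (c ∷ r) → s ⊆ᵣ r
⊆ᵣ-tail bs⊆cr y = bs⊆cr (F.suc y)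

⊆ᴳ-∷ : ∀ {m n} {s r : Vec Bool n} {S M : BipGraph m n} → s ⊆ᵣ r → S ⊆ᴳ M → (s ∷ S) ⊆ᴳ (r ∷ M)
⊆ᴳ-∷ s⊆r S⊆M F.zero    = s⊆r
⊆ᴳ-∷ s⊆r S⊆M (F.suc x) = S⊆M x

⊆ᴳ-head : ∀ {m n} {s r : Vec Bool n} {S M : BipGraph m n} → (s ∷ S) ⊆ᴳ (r ∷ M) → s ⊆ᵣ r
⊆ᴳ-head sS⊆rM = sS⊆rM F.zero

⊆ᴳ-tail : ∀ {m n} {s r : Vec Bool n} {S M : BipGraph m n} → (s ∷ S) ⊆ᴳ (r ∷ M) → S ⊆ᴳ M
⊆ᴳ-tail sS⊆rM x = sS⊆rM (F.suc x)

⊆ᴳ-trans : ∀ {m n} {S T U : BipGraph m n} → S ⊆ᴳ T → T ⊆ᴳ U → S ⊆ᴳ U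
⊆ᴳ-trans S⊆T T⊆U x y Sxy = T⊆U x y (S⊆T x y Sxy)

-- Deleting edges

rowEdges-≔false : ∀ {n} (r : Vec Bool n) y → lookup r y ≡ true → rowEdges r ≡ suc (rowEdges (r [ y ]≔ false))
rowEdges-≔false (true  ∷ r) F.zero    _  = refl
rowEdges-≔false (true  ∷ r) (F.suc y) ry = cong suc (rowEdges-≔false r y ry)
rowEdges-≔false (false ∷ r) (F.suc y) ry = rowEdges-≔false r y ry

rowEdges-≔false-≤ : ∀ {n} (r : Vec Bool n) y → rowEdges r ≤ suc (rowEdges (r [ y ]≔ false))
rowEdges-≔false-≤ (true  ∷ r) F.zero    = ≤-refl
rowEdges-≔false-≤ (false ∷ r) F.zero    = n≤1+n _
rowEdges-≔false-≤ (true  ∷ r) (F.suc y) = s≤s (rowEdges-≔false-≤ r y)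
rowEdges-≔false-≤ (false ∷ r) (F.suc y) = rowEdges-≔false-≤ r y

removeEdge : ∀ {m n} → BipGraph m n → Fin m → Fin n → BipGraph m n
removeEdge T x y = T [ x ]%= (_[ y ]≔ false)

edges-removeEdge : ∀ {m n} (T : BipGraph m n) x y → Adj T x y → edges T ≡ suc (edges (removeEdge T x y))
edges-removeEdge (r ∷ T) F.zero    y rxy = cong (_+ edges T) (rowEdges-≔false r y rxy)
edges-removeEdge (r ∷ T) (F.suc x) y Txy =
  trans (cong (rowEdges r +_) (edges-removeEdge T x y Txy)) (+-suc _ _)

edges-removeEdge-≤ : ∀ {m n} (T : BipGraph m n) x y → edges T ≤ suc (edges (removeEdge T x y))
edges-removeEdge-≤ (r ∷ T) F.zero    y = +-monoˡ-≤ (edges T) (rowEdges-≔false-≤ r y)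
edges-removeEdge-≤ (r ∷ T) (F.suc x) y =
  ≤-trans (+-monoʳ-≤ (rowEdges r) (edges-removeEdge-≤ T x y)) (≤-reflexive (+-suc _ _))

lookup-removeEdge : ∀ {m n} (T : BipGraph m n) x y x′ y′ →
  lookup (lookup (removeEdge T x y) x′) y′ ≡ lookup (lookup T x′) y′ ⊎ (x′ ≡ x × y′ ≡ y)
lookup-removeEdge T x y x′ y′ with x′ FP.≟ x
... | no x′≢x = inj₁ (cong (λ r → lookup r y′) (VP.lookup∘updateAt′ x′ x x′≢x T))
... | yes refl with y′ FP.≟ y
...   | no y′≢y = inj₁ (trans (cong (λ r → lookup r y′) (VP.lookup∘updateAt x′ T))
                               (VP.lookup∘updateAt′ y′ y y′≢y (lookup T x′)))
...   | yes refl = inj₂ (refl , refl)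

removeEdge-removes : ∀ {m n} (T : BipGraph m n) x y → ¬ Adj (removeEdge T x y) x y
removeEdge-removes T x y Txy with () ← trans (sym Txy)
  (trans (cong (λ r → lookup r y) (VP.lookup∘updateAt x T)) (VP.lookup∘updateAt y (lookup T x)))

removeEdge-⊆ : ∀ {m n} (T : BipGraph m n) x y → removeEdge T x y ⊆ᴳ T
removeEdge-⊆ T x y x′ y′ T′x′y′ with lookup-removeEdge T x y x′ y′
... | inj₁ same        = trans (sym same) T′x′y′
... | inj₂ (refl , refl) = ⊥-elim (removeEdge-removes T x y T′x′y′)

removeEdge-keeps : ∀ {m n} (T : BipGraph m n) x y x′ y′ →
  ¬ (x′ ≡ x × y′ ≡ y) → Adj T x′ y′ → Adj (removeEdge T x y) x′ y′
removeEdge-keeps T x y x′ y′ other Tx′y′ with lookup-removeEdge T x y x′ y′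
... | inj₁ same  = trans same Tx′y′
... | inj₂ equal = ⊥-elim (other equal)

removeEdge-≢ : ∀ {m n} (T : BipGraph m n) x y x′ y′ → Adj (removeEdge T x y) x′ y′ → ¬ (x′ ≡ x × y′ ≡ y)
removeEdge-≢ T x y x′ y′ T′x′y′ (refl , refl) = removeEdge-removes T x y T′x′y′

rowEdges≡suc⇒edge : ∀ {n k} (r : Vec Bool n) → rowEdges r ≡ suc k → ∃[ y ] lookup r y ≡ true
rowEdges≡suc⇒edge (true  ∷ r) _ = F.zero , refl
rowEdges≡suc⇒edge (false ∷ r) e with y , ry ← rowEdges≡suc⇒edge r e = F.suc y , ry

edges≡suc⇒edge : ∀ {m n k} (T : BipGraph m n) → edges T ≡ suc k → ∃[ x ] ∃[ y ] Adj T x y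
edges≡suc⇒edge (r ∷ T) e with rowEdges r in er
... | suc _ with y , ry ← rowEdges≡suc⇒edge r er = F.zero , y , ry
... | zero  with x , y , Txy ← edges≡suc⇒edge T e = F.suc x , y , Txy

PreservesEdges : ∀ {a b m n} → (Fin a → Fin m) → (Fin b → Fin n) → BipGraph a b → BipGraph m n → Set
PreservesEdges f g P Q = ∀ i j → Adj P i j → Adj Q (f i) (g j)

-- Induction on e(P): delete an edge of P together with its image in Q.
edges-mono-injective : ∀ {a b m n} {f : Fin a → Fin m} {g : Fin b → Fin n} →
  Injective _≡_ _≡_ f → Injective _≡_ _≡_ g →
  (P : BipGraph a b) (Q : BipGraph m n) → PreservesEdges f g P Q → edges P ≤ edges Q
edges-mono-injective {f = f} {g} f-inj g-inj P Q hom = go (edges P) P Q refl hom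
  where
  go : ∀ k (P : BipGraph _ _) (Q : BipGraph _ _) → edges P ≡ k → PreservesEdges f g P Q → edges P ≤ edges Q
  go zero    P Q eP hom = subst (_≤ edges Q) (sym eP) z≤n
  go (suc k) P Q eP hom with i , j , Pij ← edges≡suc⇒edge P eP = begin
      edges P                            ≡⟨ edges-removeEdge P i j Pij ⟩
      suc (edges P′)                     ≤⟨ s≤s (go k P′ Q′ (suc-injective (trans (sym (edges-removeEdge P i j Pij)) eP)) hom′) ⟩
      suc (edges Q′)                     ≡⟨ sym (edges-removeEdge Q (f i) (g j) (hom i j Pij)) ⟩
      edges Q                            ∎
    where
    open ≤-Reasoning
    P′ = removeEdge P i j
    Q′ = removeEdge Q (f i) (g j)
    hom′ : PreservesEdges f g P′ Q′
    hom′ i′ j′ P′i′j′ = removeEdge-keeps Q (f i) (g j) (f i′) (g j′)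
      (λ (fi′≡fi , gj′≡gj) → removeEdge-≢ P i j i′ j′ P′i′j′ (f-inj fi′≡fi , g-inj gj′≡gj))
      (hom i′ j′ (removeEdge-⊆ P i j i′ j′ P′i′j′))

removeEdges : ∀ {m n} → List (Fin m × Fin n) → BipGraph m n → BipGraph m n
removeEdges []             S = S
removeEdges ((x , y) ∷ D) S = removeEdge (removeEdges D S) x y

edges-removeEdges-≤ : ∀ {m n} (D : List (Fin m × Fin n)) S → edges S ≤ edges (removeEdges D S) + length D
edges-removeEdges-≤ [] S = ≤-reflexive (sym (+-identityʳ _))
edges-removeEdges-≤ ((x , y) ∷ D) S = begin
    edges S                                          ≤⟨ edges-removeEdges-≤ D S ⟩
    edges (removeEdges D S) + length D               ≤⟨ +-monoˡ-≤ (length D) (edges-removeEdge-≤ (removeEdges D S) x y) ⟩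
    suc (edges (removeEdges ((x , y) ∷ D) S)) + length D ≡⟨ sym (+-suc _ _) ⟩
    edges (removeEdges ((x , y) ∷ D) S) + suc (length D) ∎
  where open ≤-Reasoning

removeEdges-⊆ : ∀ {m n} (D : List (Fin m × Fin n)) S → removeEdges D S ⊆ᴳ S
removeEdges-⊆ []             S x y Sxy = Sxy
removeEdges-⊆ ((x₀ , y₀) ∷ D) S x y Sxy =
  removeEdges-⊆ D S x y (removeEdge-⊆ (removeEdges D S) x₀ y₀ x y Sxy)

removeEdges-removes : ∀ {m n} (D : List (Fin m × Fin n)) S x y → (x , y) ∈ D → ¬ Adj (removeEdges D S) x y
removeEdges-removes ((x , y) ∷ D) S x y (here refl) = removeEdge-removes (removeEdges D S) x y
removeEdges-removes ((x₀ , y₀) ∷ D) S x y (there xy∈D) Sxy =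
  removeEdges-removes D S x y xy∈D (removeEdge-⊆ (removeEdges D S) x₀ y₀ x y Sxy)


-- Random subgraphs

indicatorᵣ : ∀ {n} → Vec Bool n → Vec Bool n → ℕ
indicatorᵣ []          []          = 1
indicatorᵣ (true  ∷ c) (true  ∷ s) = indicatorᵣ c s
indicatorᵣ (true  ∷ c) (false ∷ s) = 0
indicatorᵣ (false ∷ c) (_     ∷ s) = indicatorᵣ c s

indicator : ∀ {m n} → BipGraph m n → BipGraph m n → ℕ
indicator []      []      = 1
indicator (c ∷ C) (s ∷ S) = indicatorᵣ c s * indicator C S

indicatorᵣ-⊆ : ∀ {n} (c s : Vec Bool n) → c ⊆ᵣ s → indicatorᵣ c s ≡ 1
indicatorᵣ-⊆ []          []          c⊆s = refl
indicatorᵣ-⊆ (true  ∷ c) (true  ∷ s) c⊆s = indicatorᵣ-⊆ c s (⊆ᵣ-tail c⊆s)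
indicatorᵣ-⊆ (true  ∷ c) (false ∷ s) c⊆s with () ← c⊆s F.zero refl
indicatorᵣ-⊆ (false ∷ c) (_     ∷ s) c⊆s = indicatorᵣ-⊆ c s (⊆ᵣ-tail c⊆s)

indicator-⊆ : ∀ {m n} (C S : BipGraph m n) → C ⊆ᴳ S → indicator C S ≡ 1
indicator-⊆ []      []      C⊆S = refl
indicator-⊆ (c ∷ C) (s ∷ S) C⊆S
  rewrite indicatorᵣ-⊆ c s (⊆ᴳ-head C⊆S) | indicator-⊆ C S (⊆ᴳ-tail C⊆S) = refl

countContained : ∀ {m n} → List (BipGraph m n) → BipGraph m n → ℕ
countContained Cs S = sum (map (λ C → indicator C S) Cs)

-- sumSubgraphs M f = Σ_{S ⊆ M} α^e(S) β^(e(M) − e(S)) f(S).  With p = α + β this is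
-- p^e(M) times the expectation of f(S) for the random subgraph S of M keeping each edge
-- independently with probability α/p.
module RandomSubgraph (α β : ℕ) where

  p : ℕ
  p = α + β

  sumSubrows : ∀ {n} → Vec Bool n → (Vec Bool n → ℕ) → ℕ
  sumSubrows []          f = f []
  sumSubrows (true  ∷ r) f = α * sumSubrows r (λ s → f (true ∷ s)) + β * sumSubrows r (λ s → f (false ∷ s))
  sumSubrows (false ∷ r) f = sumSubrows r (λ s → f (false ∷ s))

  sumSubgraphs : ∀ {m n} → BipGraph m n → (BipGraph m n → ℕ) → ℕ
  sumSubgraphs []      f = f []
  sumSubgraphs (r ∷ M) f = sumSubrows r (λ s → sumSubgraphs M (λ S → f (s ∷ S)))

  sumSubrows-cong : ∀ {n} (r : Vec Bool n) {f g : Vec Bool n → ℕ} → (∀ s → f s ≡ g s) →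
    sumSubrows r f ≡ sumSubrows r g
  sumSubrows-cong []          f≗g = f≗g []
  sumSubrows-cong (true  ∷ r) f≗g =
    cong₂ (λ u v → α * u + β * v) (sumSubrows-cong r (λ _ → f≗g _)) (sumSubrows-cong r (λ _ → f≗g _))
  sumSubrows-cong (false ∷ r) f≗g = sumSubrows-cong r (λ _ → f≗g _)

  sumSubrows-mono : ∀ {n} (r : Vec Bool n) {f g : Vec Bool n → ℕ} → (∀ s → s ⊆ᵣ r → f s ≤ g s) →
    sumSubrows r f ≤ sumSubrows r g
  sumSubrows-mono []          f≤g = f≤g [] (λ ())
  sumSubrows-mono (true  ∷ r) f≤g =
    +-mono-≤ (*-monoʳ-≤ α (sumSubrows-mono r (λ s s⊆r → f≤g _ (⊆ᵣ-∷true true s⊆r))))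
             (*-monoʳ-≤ β (sumSubrows-mono r (λ s s⊆r → f≤g _ (⊆ᵣ-∷true false s⊆r))))
  sumSubrows-mono (false ∷ r) f≤g = sumSubrows-mono r (λ s s⊆r → f≤g _ (⊆ᵣ-∷false s⊆r))

  sumSubrows-+ : ∀ {n} (r : Vec Bool n) (f g : Vec Bool n → ℕ) →
    sumSubrows r (λ s → f s + g s) ≡ sumSubrows r f + sumSubrows r g
  sumSubrows-+ []          f g = refl
  sumSubrows-+ (true  ∷ r) f g
    rewrite sumSubrows-+ r (λ s → f (true ∷ s)) (λ s → g (true ∷ s))
          | sumSubrows-+ r (λ s → f (false ∷ s)) (λ s → g (false ∷ s)) = regroup α β _ _ _ _
    where
    regroup : ∀ a b x y u v → a * (x + u) + b * (y + v) ≡ (a * x + b * y) + (a * u + b * v)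
    regroup = solve-∀
  sumSubrows-+ (false ∷ r) f g = sumSubrows-+ r _ _

  sumSubrows-* : ∀ {n} (r : Vec Bool n) c (f : Vec Bool n → ℕ) →
    sumSubrows r (λ s → c * f s) ≡ c * sumSubrows r f
  sumSubrows-* []          c f = refl
  sumSubrows-* (true  ∷ r) c f
    rewrite sumSubrows-* r c (λ s → f (true ∷ s)) | sumSubrows-* r c (λ s → f (false ∷ s)) = factor α β c _ _
    where
    factor : ∀ a b c x y → a * (c * x) + b * (c * y) ≡ c * (a * x + b * y)
    factor = solve-∀
  sumSubrows-* (false ∷ r) c f = sumSubrows-* r c _

  sumSubrows-const : ∀ {n} (r : Vec Bool n) c → sumSubrows r (λ _ → c) ≡ c * p ^ rowEdges r
  sumSubrows-const []          c = sym (*-identityʳ c)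
  sumSubrows-const (true  ∷ r) c rewrite sumSubrows-const r c = factor α β c (p ^ rowEdges r)
    where
    factor : ∀ a b c x → a * (c * x) + b * (c * x) ≡ c * ((a + b) * x)
    factor = solve-∀
  sumSubrows-const (false ∷ r) c = sumSubrows-const r c

  sumSubrows-rowEdges : ∀ {n} (r : Vec Bool n) → p * sumSubrows r rowEdges ≡ α * rowEdges r * p ^ rowEdges r
  sumSubrows-rowEdges []          = trans (*-zeroʳ p) (sym (cong (_* 1) (*-zeroʳ α)))
  sumSubrows-rowEdges (true  ∷ r) = begin
      p * (α * sumSubrows r (λ s → 1 + rowEdges s) + β * Σe)
    ≡⟨ cong (λ t → p * (α * t + β * Σe)) (trans (sumSubrows-+ r (λ _ → 1) rowEdges)
                                                (cong (_+ Σe) (sumSubrows-const r 1))) ⟩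
      p * (α * (1 * p ^ k + Σe) + β * Σe)
    ≡⟨ expand α β (p ^ k) Σe ⟩
      α * (p ^ k * p) + p * (p * Σe)
    ≡⟨ cong (λ t → α * (p ^ k * p) + p * t) (sumSubrows-rowEdges r) ⟩
      α * (p ^ k * p) + p * (α * k * p ^ k)
    ≡⟨ collect α β k (p ^ k) ⟩
      α * suc k * (p * p ^ k) ∎
    where
    open ≡-Reasoning
    k  = rowEdges r
    Σe = sumSubrows r rowEdges
    expand : ∀ a b x w → (a + b) * (a * (1 * x + w) + b * w) ≡ a * (x * (a + b)) + (a + b) * ((a + b) * w)
    expand = solve-∀
    collect : ∀ a b k x → a * (x * (a + b)) + (a + b) * (a * k * x) ≡ a * suc k * ((a + b) * x)
    collect = solve-∀
  sumSubrows-rowEdges (false ∷ r) = sumSubrows-rowEdges r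

  sumSubrows-indicatorᵣ : ∀ {n} (r c : Vec Bool n) → c ⊆ᵣ r →
    sumSubrows r (indicatorᵣ c) * p ^ rowEdges c ≡ α ^ rowEdges c * p ^ rowEdges r
  sumSubrows-indicatorᵣ []          []          c⊆r = refl
  sumSubrows-indicatorᵣ (true  ∷ r) (true  ∷ c) c⊆r = begin
      (α * Σc + β * sumSubrows r (λ _ → 0)) * (p * p ^ rowEdges c)
    ≡⟨ cong (λ t → (α * Σc + β * t) * (p * p ^ rowEdges c)) (sumSubrows-const r 0) ⟩
      (α * Σc + β * (0 * p ^ rowEdges r)) * (p * p ^ rowEdges c)
    ≡⟨ regroup α β Σc (p ^ rowEdges c) (p ^ rowEdges r) ⟩
      α * p * (Σc * p ^ rowEdges c)
    ≡⟨ cong (α * p *_) (sumSubrows-indicatorᵣ r c (⊆ᵣ-tail c⊆r)) ⟩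
      α * p * (α ^ rowEdges c * p ^ rowEdges r)
    ≡⟨ swap α p (α ^ rowEdges c) (p ^ rowEdges r) ⟩
      α * α ^ rowEdges c * (p * p ^ rowEdges r) ∎
    where
    open ≡-Reasoning
    Σc = sumSubrows r (indicatorᵣ c)
    regroup : ∀ a b w x y → (a * w + b * (0 * y)) * ((a + b) * x) ≡ a * (a + b) * (w * x)
    regroup = solve-∀
    swap : ∀ a q x y → a * q * (x * y) ≡ a * x * (q * y)
    swap = solve-∀
  sumSubrows-indicatorᵣ (true  ∷ r) (false ∷ c) c⊆r = begin
      (α * Σc + β * Σc) * p ^ rowEdges c
    ≡⟨ regroup α β Σc (p ^ rowEdges c) ⟩
      p * (Σc * p ^ rowEdges c)
    ≡⟨ cong (p *_) (sumSubrows-indicatorᵣ r c (⊆ᵣ-tail c⊆r)) ⟩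
      p * (α ^ rowEdges c * p ^ rowEdges r)
    ≡⟨ swap p (α ^ rowEdges c) (p ^ rowEdges r) ⟩
      α ^ rowEdges c * (p * p ^ rowEdges r) ∎
    where
    open ≡-Reasoning
    Σc = sumSubrows r (indicatorᵣ c)
    regroup : ∀ a b w x → (a * w + b * w) * x ≡ (a + b) * (w * x)
    regroup = solve-∀
    swap : ∀ q x y → q * (x * y) ≡ x * (q * y)
    swap = solve-∀
  sumSubrows-indicatorᵣ (false ∷ r) (true  ∷ c) c⊆r with () ← c⊆r F.zero refl
  sumSubrows-indicatorᵣ (false ∷ r) (false ∷ c) c⊆r = sumSubrows-indicatorᵣ r c (⊆ᵣ-tail c⊆r)

  sumSubgraphs-cong : ∀ {m n} (M : BipGraph m n) {f g : BipGraph m n → ℕ} → (∀ S → f S ≡ g S) →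
    sumSubgraphs M f ≡ sumSubgraphs M g
  sumSubgraphs-cong []      f≗g = f≗g []
  sumSubgraphs-cong (r ∷ M) f≗g = sumSubrows-cong r (λ _ → sumSubgraphs-cong M (λ _ → f≗g _))

  sumSubgraphs-mono : ∀ {m n} (M : BipGraph m n) {f g : BipGraph m n → ℕ} → (∀ S → S ⊆ᴳ M → f S ≤ g S) →
    sumSubgraphs M f ≤ sumSubgraphs M g
  sumSubgraphs-mono []      f≤g = f≤g [] (λ ())
  sumSubgraphs-mono (r ∷ M) f≤g =
    sumSubrows-mono r (λ s s⊆r → sumSubgraphs-mono M (λ S S⊆M → f≤g _ (⊆ᴳ-∷ s⊆r S⊆M)))

  sumSubgraphs-+ : ∀ {m n} (M : BipGraph m n) (f g : BipGraph m n → ℕ) →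
    sumSubgraphs M (λ S → f S + g S) ≡ sumSubgraphs M f + sumSubgraphs M g
  sumSubgraphs-+ []      f g = refl
  sumSubgraphs-+ (r ∷ M) f g = trans (sumSubrows-cong r (λ _ → sumSubgraphs-+ M _ _)) (sumSubrows-+ r _ _)

  sumSubgraphs-* : ∀ {m n} (M : BipGraph m n) c (f : BipGraph m n → ℕ) →
    sumSubgraphs M (λ S → c * f S) ≡ c * sumSubgraphs M f
  sumSubgraphs-* []      c f = refl
  sumSubgraphs-* (r ∷ M) c f = trans (sumSubrows-cong r (λ _ → sumSubgraphs-* M c _)) (sumSubrows-* r c _)

  sumSubgraphs-const : ∀ {m n} (M : BipGraph m n) c → sumSubgraphs M (λ _ → c) ≡ c * p ^ edges M
  sumSubgraphs-const []      c = sym (*-identityʳ c)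
  sumSubgraphs-const (r ∷ M) c = begin
      sumSubrows r (λ _ → sumSubgraphs M (λ _ → c)) ≡⟨ sumSubrows-cong r (λ _ → sumSubgraphs-const M c) ⟩
      sumSubrows r (λ _ → c * p ^ edges M)          ≡⟨ sumSubrows-const r _ ⟩
      c * p ^ edges M * p ^ rowEdges r              ≡⟨ swap c (p ^ edges M) (p ^ rowEdges r) ⟩
      c * (p ^ rowEdges r * p ^ edges M)            ≡⟨ cong (c *_) (^-distribˡ-+-* p (rowEdges r) (edges M)) ⟨
      c * p ^ (rowEdges r + edges M)                ∎
    where
    open ≡-Reasoning
    swap : ∀ c x y → c * x * y ≡ c * (y * x)
    swap = solve-∀

  -- Linearity of expectation: E[e(S)] = (α/p) e(M).
  sumSubgraphs-edges : ∀ {m n} (M : BipGraph m n) → p * sumSubgraphs M edges ≡ α * edges M * p ^ edges M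
  sumSubgraphs-edges []      = trans (*-zeroʳ p) (sym (cong (_* 1) (*-zeroʳ α)))
  sumSubgraphs-edges (r ∷ M) = begin
      p * sumSubrows r (λ s → sumSubgraphs M (λ S → rowEdges s + edges S))
    ≡⟨ cong (p *_) (sumSubrows-cong r λ s →
         trans (sumSubgraphs-+ M (λ _ → rowEdges s) edges)
               (cong (_+ Σe) (trans (sumSubgraphs-const M (rowEdges s)) (*-comm (rowEdges s) P)))) ⟩
      p * sumSubrows r (λ s → P * rowEdges s + Σe)
    ≡⟨ cong (p *_) (trans (sumSubrows-+ r _ _) (cong₂ _+_ (sumSubrows-* r P rowEdges) (sumSubrows-const r Σe))) ⟩
      p * (P * sumSubrows r rowEdges + Σe * p ^ k)
    ≡⟨ expand p P (sumSubrows r rowEdges) Σe (p ^ k) ⟩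
      P * (p * sumSubrows r rowEdges) + (p * Σe) * p ^ k
    ≡⟨ cong₂ (λ u v → P * u + v * p ^ k) (sumSubrows-rowEdges r) (sumSubgraphs-edges M) ⟩
      P * (α * k * p ^ k) + α * edges M * P * p ^ k
    ≡⟨ collect α P k (edges M) (p ^ k) ⟩
      α * (k + edges M) * (p ^ k * P)
    ≡⟨ cong (α * (k + edges M) *_) (^-distribˡ-+-* p k (edges M)) ⟨
      α * (k + edges M) * p ^ (k + edges M) ∎
    where
    open ≡-Reasoning
    k  = rowEdges r
    P  = p ^ edges M
    Σe = sumSubgraphs M edges
    expand : ∀ p P w e x → p * (P * w + e * x) ≡ P * (p * w) + (p * e) * x
    expand = solve-∀
    collect : ∀ a P k e x → P * (a * k * x) + a * e * P * x ≡ a * (k + e) * (x * P)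
    collect = solve-∀

  -- A fixed C ⊆ M survives with probability (α/p)^e(C).
  sumSubgraphs-indicator : ∀ {m n} (M C : BipGraph m n) → C ⊆ᴳ M →
    sumSubgraphs M (indicator C) * p ^ edges C ≡ α ^ edges C * p ^ edges M
  sumSubgraphs-indicator []      []      C⊆M = refl
  sumSubgraphs-indicator (r ∷ M) (c ∷ C) C⊆M = begin
      sumSubrows r (λ s → sumSubgraphs M (λ S → indicatorᵣ c s * indicator C S)) * p ^ (k + edges C)
    ≡⟨ cong (_* p ^ (k + edges C)) (trans (sumSubrows-cong r λ s →
         trans (sumSubgraphs-* M (indicatorᵣ c s) (indicator C)) (*-comm (indicatorᵣ c s) ΣC))
         (sumSubrows-* r ΣC (indicatorᵣ c))) ⟩
      ΣC * sumSubrows r (indicatorᵣ c) * p ^ (k + edges C)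
    ≡⟨ cong (ΣC * sumSubrows r (indicatorᵣ c) *_) (^-distribˡ-+-* p k (edges C)) ⟩
      ΣC * sumSubrows r (indicatorᵣ c) * (p ^ k * p ^ edges C)
    ≡⟨ regroup ΣC (sumSubrows r (indicatorᵣ c)) (p ^ k) (p ^ edges C) ⟩
      (ΣC * p ^ edges C) * (sumSubrows r (indicatorᵣ c) * p ^ k)
    ≡⟨ cong₂ _*_ (sumSubgraphs-indicator M C (⊆ᴳ-tail C⊆M)) (sumSubrows-indicatorᵣ r c (⊆ᴳ-head C⊆M)) ⟩
      (α ^ edges C * p ^ edges M) * (α ^ k * p ^ rowEdges r)
    ≡⟨ regroup′ (α ^ edges C) (p ^ edges M) (α ^ k) (p ^ rowEdges r) ⟩
      (α ^ k * α ^ edges C) * (p ^ rowEdges r * p ^ edges M)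
    ≡⟨ cong₂ _*_ (^-distribˡ-+-* α k (edges C)) (^-distribˡ-+-* p (rowEdges r) (edges M)) ⟨
      α ^ (k + edges C) * p ^ (rowEdges r + edges M) ∎
    where
    open ≡-Reasoning
    k  = rowEdges c
    ΣC = sumSubgraphs M (indicator C)
    regroup : ∀ x w a b → x * w * (a * b) ≡ (x * b) * (w * a)
    regroup = solve-∀
    regroup′ : ∀ a b c d → (a * b) * (c * d) ≡ (c * a) * (d * b)
    regroup′ = solve-∀

  module _ .{{_ : NonZero p}} where

    sumSubgraphs-indicator-≤ : ∀ {m n} (M C : BipGraph m n) h → C ⊆ᴳ M → h ≤ edges C →
      sumSubgraphs M (indicator C) * p ^ h ≤ α ^ h * p ^ edges M
    sumSubgraphs-indicator-≤ M C h C⊆M h≤eC with d , h+d≡eC ← m≤n⇒∃[o]m+o≡n h≤eC =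
      *-cancelʳ-≤ _ _ (p ^ d) {{m^n≢0 p d}} (begin
        ΣC * p ^ h * p ^ d           ≡⟨ *-assoc ΣC (p ^ h) (p ^ d) ⟩
        ΣC * (p ^ h * p ^ d)         ≡⟨ cong (ΣC *_) (^-distribˡ-+-* p h d) ⟨
        ΣC * p ^ (h + d)             ≡⟨ cong (λ t → ΣC * p ^ t) h+d≡eC ⟩
        ΣC * p ^ edges C             ≡⟨ sumSubgraphs-indicator M C C⊆M ⟩
        α ^ edges C * p ^ edges M    ≡⟨ cong (λ t → α ^ t * p ^ edges M) h+d≡eC ⟨
        α ^ (h + d) * p ^ edges M    ≡⟨ cong (_* p ^ edges M) (^-distribˡ-+-* α h d) ⟩
        α ^ h * α ^ d * p ^ edges M  ≤⟨ *-monoˡ-≤ (p ^ edges M) (*-monoʳ-≤ (α ^ h) (^-monoˡ-≤ d (m≤m+n α β))) ⟩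
        α ^ h * p ^ d * p ^ edges M  ≡⟨ swap (α ^ h) (p ^ d) (p ^ edges M) ⟩
        α ^ h * p ^ edges M * p ^ d  ∎)
      where
      open ≤-Reasoning
      ΣC = sumSubgraphs M (indicator C)
      swap : ∀ a b c → a * b * c ≡ a * c * b
      swap = solve-∀

    sumSubgraphs-countContained-≤ : ∀ {m n} (M : BipGraph m n) (Cs : List (BipGraph m n)) h →
      All (λ C → C ⊆ᴳ M × h ≤ edges C) Cs →
      sumSubgraphs M (countContained Cs) * p ^ h ≤ length Cs * (α ^ h * p ^ edges M)
    sumSubgraphs-countContained-≤ M []       h []                = ≤-reflexive (cong (_* p ^ h) (sumSubgraphs-const M 0))
    sumSubgraphs-countContained-≤ M (C ∷ Cs) h ((C⊆M , h≤eC) ∷ rest) = begin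
        sumSubgraphs M (λ S → indicator C S + countContained Cs S) * p ^ h
      ≡⟨ cong (_* p ^ h) (sumSubgraphs-+ M (indicator C) (countContained Cs)) ⟩
        (sumSubgraphs M (indicator C) + sumSubgraphs M (countContained Cs)) * p ^ h
      ≡⟨ *-distribʳ-+ (p ^ h) (sumSubgraphs M (indicator C)) _ ⟩
        sumSubgraphs M (indicator C) * p ^ h + sumSubgraphs M (countContained Cs) * p ^ h
      ≤⟨ +-mono-≤ (sumSubgraphs-indicator-≤ M C h C⊆M h≤eC) (sumSubgraphs-countContained-≤ M Cs h rest) ⟩
        α ^ h * p ^ edges M + length Cs * (α ^ h * p ^ edges M) ∎
      where open ≤-Reasoning

    -- Averaging "e(S) ≤ z + #{C ∈ Cs : C ⊆ S}" over the random S ⊆ M gives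
    -- (α/p) e(M) ≤ z + |Cs| (α/p)^h, here multiplied by p^(h+1).
    averaging-bound : ∀ {m n} (M : BipGraph m n) (Cs : List (BipGraph m n)) z h →
      All (λ C → C ⊆ᴳ M × h ≤ edges C) Cs →
      (∀ S → S ⊆ᴳ M → edges S ≤ z + countContained Cs S) →
      α * edges M * p ^ h ≤ p * z * p ^ h + p * (length Cs * α ^ h)
    averaging-bound M Cs z h Cs⊆M bound = *-cancelʳ-≤ _ _ P {{m^n≢0 p (edges M)}} (begin
        α * edges M * p ^ h * P                       ≡⟨ swap (α * edges M) (p ^ h) P ⟩
        α * edges M * P * p ^ h                       ≡⟨ cong (_* p ^ h) (sumSubgraphs-edges M) ⟨
        p * sumSubgraphs M edges * p ^ h              ≤⟨ *-monoˡ-≤ (p ^ h) (*-monoʳ-≤ p (sumSubgraphs-mono M bound)) ⟩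
        p * sumSubgraphs M (λ S → z + countContained Cs S) * p ^ h
          ≡⟨ cong (λ t → p * t * p ^ h) (trans (sumSubgraphs-+ M (λ _ → z) (countContained Cs))
                                               (cong (_+ ΣCs) (sumSubgraphs-const M z))) ⟩
        p * (z * P + ΣCs) * p ^ h                     ≡⟨ expand p (z * P) ΣCs (p ^ h) ⟩
        p * (z * P) * p ^ h + p * (ΣCs * p ^ h)
          ≤⟨ +-monoʳ-≤ (p * (z * P) * p ^ h) (*-monoʳ-≤ p (sumSubgraphs-countContained-≤ M Cs h Cs⊆M)) ⟩
        p * (z * P) * p ^ h + p * (length Cs * (α ^ h * P)) ≡⟨ collect p z P (p ^ h) (length Cs) (α ^ h) ⟩
        (p * z * p ^ h + p * (length Cs * α ^ h)) * P ∎)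
      where
      open ≤-Reasoning
      P   = p ^ edges M
      ΣCs = sumSubgraphs M (countContained Cs)
      swap : ∀ a b c → a * b * c ≡ a * c * b
      swap = solve-∀
      expand : ∀ p a b c → p * (a + b) * c ≡ p * a * c + p * (b * c)
      expand = solve-∀
      collect : ∀ p z P x l a → p * (z * P) * x + p * (l * (a * P)) ≡ (p * z * x + p * (l * a)) * P
      collect = solve-∀

-- The list of all signed copies

doesTrue⇔ : ∀ {A : Set} (A? : Dec A) → (does A? ≡ true) ⇔ A
doesTrue⇔ (yes a)  = mk⇔ (λ _ → a) (λ _ → refl)
doesTrue⇔ (no ¬a) = mk⇔ (λ ()) (⊥-elim ∘ ¬a)

lookup-tabulate-does : ∀ {n} {P : Fin n → Set} (P? : ∀ x → Dec (P x)) x →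
  (lookup (tabulate (λ x → does (P? x))) x ≡ true) ⇔ P x
lookup-tabulate-does P? x =
  subst (λ b → (b ≡ true) ⇔ _) (sym (VP.lookup∘tabulate (λ x → does (P? x)) x)) (doesTrue⇔ (P? x))

allVec : ∀ {m} k → List (Vec (Fin m) k)
allVec zero        = [] ∷ []
allVec {m} (suc k) = cartesianProductWith _∷_ (allFin m) (allVec k)

∈-allVec : ∀ {m k} (v : Vec (Fin m) k) → v ∈ allVec k
∈-allVec []      = here refl
∈-allVec (x ∷ v) = ∈-cartesianProductWith⁺ _∷_ (∈-allFin x) (∈-allVec v)

injective? : ∀ {a m} (f : Fin a → Fin m) → Dec (Injective _≡_ _≡_ f)
injective? f = map′ (λ inj {i} {j} → inj i j) (λ inj i j → inj)
  (FP.all? λ i → FP.all? λ j → (f i FP.≟ f j) →-dec (i FP.≟ j))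

imageSet : ∀ {k m} → (Fin k → Fin m) → Subset m
imageSet f = tabulate λ x → does (FP.any? λ i → f i FP.≟ x)

∈-imageSet : ∀ {k m} (f : Fin k → Fin m) x → (x ∈ₛ imageSet f) ⇔ (∃[ i ] f i ≡ x)
∈-imageSet f x = mk⇔ (to ∘ VP.[]=⇒lookup) (VP.lookup⇒[]= x _ ∘ from)
  where open Equivalence (lookup-tabulate-does (λ x → FP.any? λ i → f i FP.≟ x) x)

module _ {a b m n} (H : BipGraph a b) (G : BipGraph m n) where

  IsEmbedding : (Fin a → Fin m) → (Fin b → Fin n) → Set
  IsEmbedding f g = Injective _≡_ _≡_ f × Injective _≡_ _≡_ g × PreservesEdges f g H G

  isEmbedding? : ∀ f g → Dec (IsEmbedding f g)
  isEmbedding? f g = injective? f ×-dec injective? g ×-dec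
    FP.all? λ i → FP.all? λ j → (lookup (lookup H i) j B.≟ true) →-dec (lookup (lookup G (f i)) (g j) B.≟ true)

  toEmbedding : ∀ {f g} → IsEmbedding f g → SignedEmbedding H G
  toEmbedding {f} {g} (f-inj , g-inj , hom) =
    record { f = f ; g = g ; f-inj = f-inj ; g-inj = g-inj ; hom = hom }

  IsEmbedding-≗ : ∀ {f f′ g g′} → (∀ i → f i ≡ f′ i) → (∀ j → g j ≡ g′ j) → IsEmbedding f g → IsEmbedding f′ g′
  IsEmbedding-≗ f≗f′ g≗g′ (f-inj , g-inj , hom) =
      (λ e → f-inj (trans (f≗f′ _) (trans e (sym (f≗f′ _)))))
    , (λ e → g-inj (trans (g≗g′ _) (trans e (sym (g≗g′ _)))))
    , (λ i j Hij → subst₂ (Adj G) (f≗f′ i) (g≗g′ j) (hom i j Hij))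

ImageEdge : ∀ {a b m n} → BipGraph a b → (Fin a → Fin m) → (Fin b → Fin n) → Fin m → Fin n → Set
ImageEdge H f g x y = ∃[ i ] ∃[ j ] (f i ≡ x × g j ≡ y × Adj H i j)

imageEdge? : ∀ {a b m n} (H : BipGraph a b) f g (x : Fin m) (y : Fin n) → Dec (ImageEdge H f g x y)
imageEdge? H f g x y = FP.any? λ i → FP.any? λ j →
  (f i FP.≟ x) ×-dec (g j FP.≟ y) ×-dec (lookup (lookup H i) j B.≟ true)

ImageEdge-≗ : ∀ {a b m n} (H : BipGraph a b) {f f′ : Fin a → Fin m} {g g′ : Fin b → Fin n} →
  (∀ i → f i ≡ f′ i) → (∀ j → g j ≡ g′ j) → ∀ {x y} → ImageEdge H f g x y → ImageEdge H f′ g′ x y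
ImageEdge-≗ H f≗f′ g≗g′ (i , j , fi≡x , gj≡y , Hij) =
  i , j , trans (sym (f≗f′ i)) fi≡x , trans (sym (g≗g′ j)) gj≡y , Hij

imageEdges : ∀ {a b m n} → BipGraph a b → (Fin a → Fin m) → (Fin b → Fin n) → BipGraph m n
imageEdges H f g = tabulate λ x → tabulate λ y → does (imageEdge? H f g x y)

Adj-imageEdges : ∀ {a b m n} (H : BipGraph a b) f g (x : Fin m) (y : Fin n) →
  Adj (imageEdges H f g) x y ⇔ ImageEdge H f g x y
Adj-imageEdges H f g x y =
  subst (λ r → (lookup r y ≡ true) ⇔ ImageEdge H f g x y)
        (sym (VP.lookup∘tabulate (λ x → tabulate λ y → does (imageEdge? H f g x y)) x))
        (lookup-tabulate-does (imageEdge? H f g x) y)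

image : ∀ {a b m n} → BipGraph a b → (Fin a → Fin m) → (Fin b → Fin n) → SubgraphData m n
image H f g = imageSet f , imageSet g , imageEdges H f g

edgeSet : ∀ {m n} → SubgraphData m n → BipGraph m n
edgeSet (_ , _ , E) = E

image-isSignedCopy : ∀ {a b m n} (H : BipGraph a b) (G : BipGraph m n) {f g} →
  (e : IsEmbedding H G f g) → IsSignedCopy H G (image H f g)
image-isSignedCopy H G {f} {g} e = toEmbedding H G e , ∈-imageSet f , ∈-imageSet g , Adj-imageEdges H f g

Covers : ∀ {a b m n} → BipGraph a b → BipGraph m n → List (BipGraph m n) → Set
Covers H G Cs = (ψ : SignedEmbedding H G) → let open SignedEmbedding ψ in
  ∃[ C ] (C ∈ Cs × (∀ x y → Adj C x y ⇔ ImageEdge H f g x y))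

_≟ˢ_ : ∀ {m n} → DecidableEquality (SubgraphData m n)
_≟ˢ_ = PP.≡-dec (VP.≡-dec B._≟_) (PP.≡-dec (VP.≡-dec B._≟_) (VP.≡-dec (VP.≡-dec B._≟_)))

module _ {a b m n} (H : BipGraph a b) (G : BipGraph m n) where

  private
    Candidate : Set
    Candidate = Vec (Fin m) a × Vec (Fin n) b

    candidates : List Candidate
    candidates = cartesianProduct (allVec a) (allVec b)

    isEmbeddingCandidate? : ∀ c → Dec (IsEmbedding H G (lookup (proj₁ c)) (lookup (proj₂ c)))
    isEmbeddingCandidate? (fv , gv) = isEmbedding? H G (lookup fv) (lookup gv)

    embeddings : List Candidate
    embeddings = filter isEmbeddingCandidate? candidates

    imageOf : Candidate → SubgraphData m n
    imageOf (fv , gv) = image H (lookup fv) (lookup gv)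

  signedCopies : List (SubgraphData m n)
  signedCopies = deduplicate _≟ˢ_ (map imageOf embeddings)

  signedCopies-unique : Unique signedCopies
  signedCopies-unique = deduplicate-! _≟ˢ_ (map imageOf embeddings)

  signedCopies-isSignedCopy : All (IsSignedCopy H G) signedCopies
  signedCopies-isSignedCopy = AllP.deduplicate⁺ _≟ˢ_ (AllP.map⁺
    (All.map (image-isSignedCopy H G) (AllP.all-filter isEmbeddingCandidate? candidates)))

  signedCopies-cover : Covers H G (map edgeSet signedCopies)
  signedCopies-cover ψ = edgeSet (imageOf (fv , gv)) , ∈-map⁺ edgeSet (∈-deduplicate⁺ _≟ˢ_ ∈images) , adj
    where
    open SignedEmbedding ψ
    fv = tabulate f
    gv = tabulate g
    lookup-fv : ∀ i → f i ≡ lookup fv i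
    lookup-fv i = sym (VP.lookup∘tabulate f i)
    lookup-gv : ∀ j → g j ≡ lookup gv j
    lookup-gv j = sym (VP.lookup∘tabulate g j)
    ∈images : imageOf (fv , gv) ∈ map imageOf embeddings
    ∈images = ∈-map⁺ imageOf (∈-filter⁺ isEmbeddingCandidate?
      (∈-cartesianProduct⁺ (∈-allVec fv) (∈-allVec gv))
      (IsEmbedding-≗ H G lookup-fv lookup-gv (f-inj , g-inj , hom)))
    adj : ∀ x y → Adj (imageEdges H (lookup fv) (lookup gv)) x y ⇔ ImageEdge H f g x y
    adj x y = mk⇔ (ImageEdge-≗ H (sym ∘ lookup-fv) (sym ∘ lookup-gv) ∘ to)
                  (from ∘ ImageEdge-≗ H lookup-fv lookup-gv)
      where open Equivalence (Adj-imageEdges H (lookup fv) (lookup gv) x y)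

-- The deletion argument

edge? : ∀ {m n} (T : BipGraph m n) → Dec (∃[ x ] ∃[ y ] Adj T x y)
edge? T = FP.any? λ x → FP.any? λ y → lookup (lookup T x) y B.≟ true

hittingEdges : ∀ {m n} → List (BipGraph m n) → BipGraph m n → List (Fin m × Fin n)
hittingEdges []       S = []
hittingEdges (C ∷ Cs) S with indicator C S ≟ 1 | edge? C
... | yes _ | yes (x , y , _) = (x , y) ∷ hittingEdges Cs S
... | _     | _               = hittingEdges Cs S

length-hittingEdges : ∀ {m n} (Cs : List (BipGraph m n)) S → length (hittingEdges Cs S) ≤ countContained Cs S
length-hittingEdges []       S = z≤n
length-hittingEdges (C ∷ Cs) S with indicator C S ≟ 1 | edge? C
... | yes C⊆S | yes _ rewrite C⊆S = s≤s (length-hittingEdges Cs S)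
... | yes _   | no _  = ≤-trans (length-hittingEdges Cs S) (m≤n+m _ _)
... | no _    | _     = ≤-trans (length-hittingEdges Cs S) (m≤n+m _ _)

hittingEdges-hits : ∀ {m n} (Cs : List (BipGraph m n)) S {C} → C ∈ Cs → C ⊆ᴳ S → ∃[ x ] ∃[ y ] Adj C x y →
  ∃[ x ] ∃[ y ] (Adj C x y × (x , y) ∈ hittingEdges Cs S)
hittingEdges-hits (C ∷ Cs) S (here refl) C⊆S C-edge with indicator C S ≟ 1 | edge? C
... | yes _ | yes (x , y , Cxy) = x , y , Cxy , here refl
... | yes _ | no no-edge        = ⊥-elim (no-edge C-edge)
... | no ≢1 | _                 = ⊥-elim (≢1 (indicator-⊆ C S C⊆S))
hittingEdges-hits (C′ ∷ Cs) S (there C∈Cs) C⊆S C-edge with indicator C′ S ≟ 1 | edge? C′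
... | yes _ | yes _ with x , y , Cxy , hit ← hittingEdges-hits Cs S C∈Cs C⊆S C-edge = x , y , Cxy , there hit
... | yes _ | no _  = hittingEdges-hits Cs S C∈Cs C⊆S C-edge
... | no _  | _     = hittingEdges-hits Cs S C∈Cs C⊆S C-edge

SignedEmbedding-⊆ : ∀ {a b m n} {H : BipGraph a b} {T T′ : BipGraph m n} →
  T ⊆ᴳ T′ → SignedEmbedding H T → SignedEmbedding H T′
SignedEmbedding-⊆ T⊆T′ ψ = record
  { f = f ; g = g ; f-inj = f-inj ; g-inj = g-inj ; hom = λ i j Hij → T⊆T′ _ _ (hom i j Hij) }
  where open SignedEmbedding ψ

SignedEmbedding-edgeless : ∀ {a b m n} {H : BipGraph a b} {T : BipGraph m n} →
  ¬ (∃[ i ] ∃[ j ] Adj H i j) → SignedEmbedding H T → (T′ : BipGraph m n) → SignedEmbedding H T′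
SignedEmbedding-edgeless edgeless ψ T′ = record
  { f = f ; g = g ; f-inj = f-inj ; g-inj = g-inj ; hom = λ i j Hij → ⊥-elim (edgeless (i , j , Hij)) }
  where open SignedEmbedding ψ

module _ {a b m n} (H : BipGraph a b) (C : BipGraph m n) {f : Fin a → Fin m} {g : Fin b → Fin n}
         (C⇔image : ∀ x y → Adj C x y ⇔ ImageEdge H f g x y) where

  image-⊆ : ∀ T → PreservesEdges f g H T → C ⊆ᴳ T
  image-⊆ T hom x y Cxy with i , j , refl , refl , Hij ← Equivalence.to (C⇔image x y) Cxy = hom i j Hij

  image-edge : ∀ {i j} → Adj H i j → Adj C (f i) (g j)
  image-edge {i} {j} Hij = Equivalence.from (C⇔image (f i) (g j)) (i , j , refl , refl , Hij)

-- Deleting one edge of every copy inside S leaves an H-free graph; an edgeless H is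
-- excluded because it would embed into the H-free witness of z as well.
edges-≤-z+countContained : ∀ {a b m n} {H : BipGraph a b} {G : BipGraph m n} {z Cs} →
  IsZarankiewicz m n H z → Covers H G Cs → ∀ S → S ⊆ᴳ G → edges S ≤ z + countContained Cs S
edges-≤-z+countContained {H = H} {G} {z} {Cs} ((G₀ , G₀-free , _) , maximal) cover S S⊆G = begin
    edges S              ≤⟨ edges-removeEdges-≤ D S ⟩
    edges S′ + length D  ≤⟨ +-mono-≤ (maximal S′ S′-free) (length-hittingEdges Cs S) ⟩
    z + countContained Cs S ∎
  where
  open ≤-Reasoning
  D  = hittingEdges Cs S
  S′ = removeEdges D S

  S′⊆S : S′ ⊆ᴳ S
  S′⊆S = removeEdges-⊆ D S

  S′⊆G : S′ ⊆ᴳ G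
  S′⊆G = ⊆ᴳ-trans {S = S′} {S} {G} S′⊆S S⊆G

  S′-free : ¬ SignedEmbedding H S′
  S′-free ψ with edge? H
  ... | no edgeless = G₀-free (SignedEmbedding-edgeless edgeless ψ G₀)
  ... | yes (i , j , Hij)
    with C , C∈Cs , C⇔image ← cover (SignedEmbedding-⊆ S′⊆G ψ)
    with x , y , Cxy , hit ← hittingEdges-hits Cs S C∈Cs
                               (image-⊆ H C C⇔image S (SignedEmbedding.hom (SignedEmbedding-⊆ {T′ = S} S′⊆S ψ)))
                               (_ , _ , image-edge H C C⇔image Hij)
    = removeEdges-removes D S x y hit (image-⊆ H C C⇔image S′ (SignedEmbedding.hom ψ) x y Cxy)

isSignedCopy-⊆ : ∀ {a b m n} (H : BipGraph a b) (G : BipGraph m n) X → IsSignedCopy H G X → edgeSet X ⊆ᴳ G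
isSignedCopy-⊆ H G (_ , _ , E) (φ , _ , _ , E⇔image) = image-⊆ H E E⇔image G hom
  where open SignedEmbedding φ

isSignedCopy-edges : ∀ {a b m n} (H : BipGraph a b) (G : BipGraph m n) X → IsSignedCopy H G X →
  edges H ≤ edges (edgeSet X)
isSignedCopy-edges H G (_ , _ , E) (φ , _ , _ , E⇔image) =
  edges-mono-injective f-inj g-inj H E (λ i j → image-edge H E E⇔image)
  where open SignedEmbedding φ

cancel-half : ∀ {p z u x N y} .{{_ : NonZero p}} →
  2 * (p * z) ≤ u → u * x ≤ p * z * x + p * (N * y) → x * z ≤ y * N
cancel-half {p} {z} {u} {x} {N} {y} 2pz≤u ux≤ = begin
    x * z      ≡⟨ *-comm x z ⟩
    z * x      ≤⟨ *-cancelˡ-≤ p (≤-trans (≤-reflexive (sym (*-assoc p z x))) (+-cancelˡ-≤ (p * z * x) _ _ twice≤)) ⟩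
    N * y      ≡⟨ *-comm N y ⟩
    y * N      ∎
  where
  open ≤-Reasoning
  twice≤ : p * z * x + p * z * x ≤ p * z * x + p * (N * y)
  twice≤ = begin
    p * z * x + p * z * x ≡⟨ double p z x ⟩
    2 * (p * z) * x       ≤⟨ *-monoˡ-≤ x 2pz≤u ⟩
    u * x                 ≤⟨ ux≤ ⟩
    p * z * x + p * (N * y) ∎
    where
    double : ∀ p z x → p * z * x + p * z * x ≡ 2 * (p * z) * x
    double = solve-∀

manySignedCopies : ∀ {a b : ℕ} (H : BipGraph a b) (m n : ℕ) (z : ℕ) → IsZarankiewicz m n H z →
  (p q : ℕ) → .{{_ : NonZero p}} → 2 * q ≤ p →
  (G : BipGraph m n) → p * z ≤ q * edges G →
  ∃[ L ] (Unique L × All (IsSignedCopy H G) L × p ^ edges H * z ≤ (2 * q) ^ edges H * length L)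
manySignedCopies H m n z zar p q 2q≤p G pz≤qe with β , refl ← m≤n⇒∃[o]m+o≡n 2q≤p =
  signedCopies H G , signedCopies-unique H G , signedCopies-isSignedCopy H G ,
  cancel-half {N = length (signedCopies H G)} 2pz≤2qe averaged
  where
  -- After matching on refl, p is 2 * q + β, which is also the module's p.
  open RandomSubgraph (2 * q) β hiding (p)
  2pz≤2qe : 2 * (p * z) ≤ 2 * q * edges G
  2pz≤2qe = ≤-trans (*-monoʳ-≤ 2 pz≤qe) (≤-reflexive (sym (*-assoc 2 q (edges G))))
  Cs = map edgeSet (signedCopies H G)
  Cs-copies : All (λ C → C ⊆ᴳ G × edges H ≤ edges C) Cs
  Cs-copies = AllP.map⁺ (All.map (λ {X} c → isSignedCopy-⊆ H G X c , isSignedCopy-edges H G X c)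
                                 (signedCopies-isSignedCopy H G))
  averaged : 2 * q * edges G * p ^ edges H ≤
             p * z * p ^ edges H + p * (length (signedCopies H G) * (2 * q) ^ edges H)
  averaged = subst (λ l → 2 * q * edges G * p ^ edges H ≤ p * z * p ^ edges H + p * (l * (2 * q) ^ edges H))
                   (length-map edgeSet (signedCopies H G))
    (averaging-bound G Cs z (edges H) Cs-copies (edges-≤-z+countContained zar (signedCopies-cover H G)))

lemma4p1 : ∀ {a b : ℕ} (H : BipGraph a b) (m n : ℕ) (z : ℕ) →
    IsZarankiewicz m n H z →
    (p q : ℕ) → .{{_ : NonZero q}} → 4 * q ≤ p →
    (G : BipGraph m n) → p * z ≤ q * edges G →
    ∃[ L ] (Unique L × All (IsSignedCopy H G) L ×
      p ^ edges H * z ≤ (2 * q) ^ edges H * length L)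
lemma4p1 H m n z zar p q 4q≤p = manySignedCopies H m n z zar p q {{p≢0}} 2q≤p
  where
  2q≤p : 2 * q ≤ p
  2q≤p = ≤-trans (*-monoˡ-≤ q (m≤m+n 2 2)) 4q≤p
  p≢0 : NonZero p
  p≢0 = >-nonZero (<-≤-trans (>-nonZero⁻¹ q) (≤-trans (m≤n*m q 4) 4q≤p))
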